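{- Let $G$ and $H$ be finite, simple, connected graphs, each with at least two vertices, and let $S_1\subseteq V(G)$, $S_2\subseteq V(H)$. If $S_1$ is a geodetic (resp. hull) set of $G$ and $S_2$ is a geodetic (resp. hull) set of $H$, then $S_1\times S_2$ is a geodetic (resp. hull) set of $G\boxtimes H$.
   Context: For a connected graph, $I[x,y]$ consists of $x$, $y$ and all vertices on some shortest $x$–$y$ path; $I[S]=\bigcup_{u,v\in S}I[u,v]$. $S$ is geodetic if $I[S]$ is the whole vertex set. A set is convex if $I[S]=S$; the convex hull $CH(S)$ is the smallest convex set containing $S$; $S$ is a hull set if $CH(S)$ is the whole vertex set. The strong product $G\boxtimes H$ has vertex set $V(G)\times V(H)$, with $(g,h)$ and $(g',h')$ adjacent whenever ($g=g'$ and $hh'\in E(H)$), or ($h=h'$ and $gg'\in E(G)$), or ($gg'\in E(G)$ and $hh'\in E(H)$). -}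

module Defs where

open import Data.Nat using (ℕ; zero; suc; _<_; _≤_)
open import Data.Fin using (Fin)
open import Data.Bool using (Bool; true; false)
open import Data.Product using (Σ; ∃; _×_; _,_)
open import Data.Sum using (_⊎_)
open import Relation.Binary.PropositionalEquality using (_≡_)
open import Relation.Nullary using (¬_)
open import Relation.Unary using (Pred; _⊆_)
open import Level using (0ℓ)
import Level

record FinGraph : Set where
  field
    n     : ℕ
    adj   : Fin n → Fin n → Bool
    irrefl : ∀ x → adj x x ≡ false
    sym   : ∀ x y → adj x y ≡ adj y x

  Vtx : Set
  Vtx = Fin n

  E : Vtx → Vtx → Set
  E x y = adj x y ≡ true

module _ {V : Set} (E : V → V → Set) where

  data Walk : V → V → ℕ → Set where
    nil  : ∀ {x} → Walk x x 0
    cons : ∀ {x z y k} → E x z → Walk z y k → Walk x y (suc k)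

  data OnWalk (v : V) : ∀ {x y k} → Walk x y k → Set where
    here  : ∀ {y k} {w : Walk v y k} → OnWalk v w
    there : ∀ {x z y k} {e : E x z} {w : Walk z y k} → OnWalk v w → OnWalk v (cons e w)

  Connected : Set
  Connected = ∀ x y → ∃ λ k → Walk x y k

  -- a shortest x–y walk of length k (necessarily a path)
  Shortest : ∀ {x y k} → Walk x y k → Set
  Shortest {x} {y} {k} _ = ∀ m → m < k → ¬ Walk x y m

  Interval : V → V → Pred V 0ℓ
  Interval x y z = Σ ℕ λ k → Σ (Walk x y k) λ w → Shortest w × OnWalk z w

  IntervalSet : Pred V 0ℓ → Pred V 0ℓ
  IntervalSet S z = Σ V λ u → Σ V λ v → S u × S v × Interval u v z

  Geodetic : Pred V 0ℓ → Set
  Geodetic S = ∀ z → IntervalSet S z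

  -- convex: I[C] ⊆ C (C ⊆ I[C] always holds)
  Convex : Pred V 0ℓ → Set
  Convex C = IntervalSet C ⊆ C

  ConvexHull : Pred V 0ℓ → Pred V (Level.suc 0ℓ)
  ConvexHull S v = ∀ (C : Pred V 0ℓ) → Convex C → S ⊆ C → C v

  HullSet : Pred V 0ℓ → Set₁
  HullSet S = ∀ v → ConvexHull S v

StrongE : (G H : FinGraph) →
          (FinGraph.Vtx G × FinGraph.Vtx H) → (FinGraph.Vtx G × FinGraph.Vtx H) → Set
StrongE G H (g , h) (g' , h') =
  (g ≡ g' × FinGraph.E H h h')
  ⊎ (h ≡ h' × FinGraph.E G g g')
  ⊎ (FinGraph.E G g g' × FinGraph.E H h h')

_⊠ˢ_ : ∀ {A B : Set} → Pred A 0ℓ → Pred B 0ℓ → Pred (A × B) 0ℓ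
(S₁ ⊠ˢ S₂) (a , b) = S₁ a × S₂ b

module Submission where

-- A homomorphism
-- carries walks to walks of the same length; a contraction (edges go to
-- edges or collapse to a vertex) carries walks to walks that are no longer.
-- If f is a homomorphism with a contraction r as left inverse, f maps
-- shortest paths to shortest paths, hence intervals into intervals
-- (intervalImage); consequently preimages of convex sets are convex.
--
-- Hull sets: the layer inclusions g ↦ (g , h) and h ↦ (g , h) are such maps
-- (with the projections as retractions), so every layer of a convex set
-- C ⊇ S₁ × S₂ is convex; two rounds of the hull property of S₁ and S₂ fill C.
--
-- Geodetic sets: write a ∈ I[x,y] with d(x,a) = i, d(a,y) = i', and let c be
-- the endpoint nearer to a, at distance α = min(i,i') (an Anchor).  If the
-- anchor of a in G is at most as far as the anchor of b in H, walking
-- diagonally from (c , x) through (a , b) to (c , y) has length d_H(x,y),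
-- which is shortest since the projection to H is a contraction.  The other
-- case follows by the swap isomorphism G ⊠ H ≅ H ⊠ G.

open import Defs
open import Data.Nat using (ℕ; suc; _+_; _≤_; _<_; z≤n; s≤s)
open import Data.Nat.Properties using (≤-refl; ≤-trans; ≤-<-trans; ≤-total; m≤n⇒m≤1+n)
open import Data.Product using (Σ; _×_; _,_; proj₁; proj₂; swap)
open import Data.Sum using (_⊎_; inj₁; inj₂)
open import Relation.Binary.Definitions using (Symmetric)
open import Relation.Binary.PropositionalEquality using (_≡_; refl; sym; trans; subst; subst₂; cong)
open import Relation.Nullary using (¬_)
open import Relation.Unary using (Pred)
open import Level using (0ℓ)

module _ {V : Set} {E : V → V → Set} where

  append : ∀ {x y z k l} → Walk E x y k → Walk E y z l → Walk E x z (k + l)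
  append nil        w₂ = w₂
  append (cons e w) w₂ = cons e (append w w₂)

  onJoin : ∀ {x y z k l} (w₁ : Walk E x y k) (w₂ : Walk E y z l) →
           OnWalk E y (append w₁ w₂)
  onJoin nil        w₂ = here
  onJoin (cons e w) w₂ = there (onJoin w w₂)

  decompose : ∀ {a x y k} {w : Walk E x y k} → OnWalk E a w →
              Σ ℕ λ i → Σ ℕ λ i' → Walk E x a i × Walk E a y i' × i + i' ≡ k
  decompose {k = k} {w = w} here = 0 , k , nil , w , refl
  decompose (there {e = e} on) with decompose on
  ... | i , i' , w₁ , w₂ , eq = suc i , i' , cons e w₁ , w₂ , cong suc eq

  snoc : ∀ {x y z k} → Walk E x y k → E y z → Walk E x z (suc k)
  snoc nil         e = cons e nil
  snoc (cons e' w) e = cons e' (snoc w e)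

  reverse : Symmetric E → ∀ {x y k} → Walk E x y k → Walk E y x k
  reverse symE nil        = nil
  reverse symE (cons e w) = snoc (reverse symE w) (symE e)

symmetric : (G : FinGraph) → Symmetric (FinGraph.E G)
symmetric G {x} {y} e = trans (FinGraph.sym G y x) e

Hom : {V W : Set} → (V → V → Set) → (W → W → Set) → (V → W) → Set
Hom E E' f = ∀ {x y} → E x y → E' (f x) (f y)

Contraction : {V W : Set} → (V → V → Set) → (W → W → Set) → (V → W) → Set
Contraction E E' f = ∀ {x y} → E x y → f x ≡ f y ⊎ E' (f x) (f y)

module _ {V W : Set} {E : V → V → Set} {E' : W → W → Set} {f : V → W} where

  homContraction : Hom E E' f → Contraction E E' f
  homContraction hom e = inj₂ (hom e)

  mapWalk : Hom E E' f → ∀ {x y k} → Walk E x y k → Walk E' (f x) (f y) k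
  mapWalk hom nil        = nil
  mapWalk hom (cons e w) = cons (hom e) (mapWalk hom w)

  onMapWalk : (hom : Hom E E' f) → ∀ {a x y k} {w : Walk E x y k} →
              OnWalk E a w → OnWalk E' (f a) (mapWalk hom w)
  onMapWalk hom here       = here
  onMapWalk hom (there on) = there (onMapWalk hom on)

  contractWalk : Contraction E E' f → ∀ {x y k} → Walk E x y k →
                 Σ ℕ λ m → m ≤ k × Walk E' (f x) (f y) m
  contractWalk con nil = 0 , z≤n , nil
  contractWalk con (cons {y = y} e w) with con e | contractWalk con w
  ... | inj₁ fx≡fz | m , m≤k , w' =
    m , m≤n⇒m≤1+n m≤k , subst (λ t → Walk E' t (f y) m) (sym fx≡fz) w'
  ... | inj₂ e'    | m , m≤k , w' = suc m , s≤s m≤k , cons e' w'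

  tightPullback : Contraction E E' f → ∀ {x y k} →
                  (∀ m → m < k → ¬ Walk E' (f x) (f y) m) →
                  (∀ m → m < k → ¬ Walk E x y m)
  tightPullback con tight m m<k w with contractWalk con w
  ... | m' , m'≤m , w' = tight m' (≤-<-trans m'≤m m<k) w'

module _ {V W : Set} {E : V → V → Set} {E' : W → W → Set} {f : V → W} {r : W → V}
         (hom : Hom E E' f) (con : Contraction E' E r) (retract : ∀ x → r (f x) ≡ x) where

  intervalImage : ∀ {x y z} → Interval E x y z → Interval E' (f x) (f y) (f z)
  intervalImage {x} {y} (k , w , shortest , on) =
    k , mapWalk hom w , tightPullback con shortest' , onMapWalk hom on
    where
      shortest' : ∀ m → m < k → ¬ Walk E (r (f x)) (r (f y)) m
      shortest' = subst₂ (λ u v → ∀ m → m < k → ¬ Walk E u v m)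
                         (sym (retract x)) (sym (retract y)) shortest

  intervalSetImage : {S : Pred V 0ℓ} {T : Pred W 0ℓ} → (∀ {v} → S v → T (f v)) →
                     ∀ {z} → IntervalSet E S z → IntervalSet E' T (f z)
  intervalSetImage S⊆T (u , v , Su , Sv , int) =
    f u , f v , S⊆T Su , S⊆T Sv , intervalImage int

  convexPullback : {C : Pred W 0ℓ} → Convex E' C → Convex E (λ v → C (f v))
  convexPullback convC int = convC (intervalSetImage (λ Cv → Cv) int)

-- A vertex a on a shortest x–y path, split into its two halves; no x–y walk
-- is shorter than the two halves together.
record Split {V : Set} (E : V → V → Set) (x a y : V) : Set where
  field
    i i'   : ℕ
    toA    : Walk E x a i
    fromA  : Walk E a y i'
    tight  : ∀ m → m < i + i' → ¬ Walk E x y m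

interval⇒split : ∀ {V} {E : V → V → Set} {x y a} → Interval E x y a → Split E x a y
interval⇒split (k , w , shortest , on) with decompose on
... | i , i' , toA , fromA , i+i'≡k = record
  { i = i ; i' = i' ; toA = toA ; fromA = fromA
  ; tight = λ m lt → shortest m (subst (m <_) i+i'≡k lt) }

split⇒interval : ∀ {V} {E : V → V → Set} {x y a} → Split E x a y → Interval E x y a
split⇒interval s = i + i' , append toA fromA , tight , onJoin toA fromA
  where open Split s

-- A vertex a of I[S] together with the endpoint c ∈ S of its geodesic that is
-- nearer to a; c is at walk distance α from a in both directions.
record Anchor {V : Set} (E : V → V → Set) (S : Pred V 0ℓ) (a : V) : Set where
  field
    x y    : V
    Sx     : S x
    Sy     : S y
    geo    : Split E x a y
    c      : V
    Sc     : S c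
    α      : ℕ
    c→a    : Walk E c a α
    a→c    : Walk E a c α
    α≤i    : α ≤ Split.i geo
    α≤i'   : α ≤ Split.i' geo

anchor : ∀ {V} {E : V → V → Set} {S : Pred V 0ℓ} {a} →
         Symmetric E → IntervalSet E S a → Anchor E S a
anchor {E = E} {S} {a} symE (x , y , Sx , Sy , int) = nearer (≤-total i i')
  where
    geo : Split E x a y
    geo = interval⇒split int
    open Split geo

    nearer : i ≤ i' ⊎ i' ≤ i → Anchor E S a
    nearer (inj₁ i≤i') = record
      { x = x ; y = y ; Sx = Sx ; Sy = Sy ; geo = geo ; c = x ; Sc = Sx ; α = i
      ; c→a = toA ; a→c = reverse symE toA ; α≤i = ≤-refl ; α≤i' = i≤i' }
    nearer (inj₂ i'≤i) = record
      { x = x ; y = y ; Sx = Sx ; Sy = Sy ; geo = geo ; c = y ; Sc = Sy ; α = i'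
      ; c→a = reverse symE fromA ; a→c = fromA ; α≤i = i'≤i ; α≤i' = ≤-refl }

module Strong (G H : FinGraph) where

  private
    EG : FinGraph.Vtx G → FinGraph.Vtx G → Set
    EG = FinGraph.E G
    EH : FinGraph.Vtx H → FinGraph.Vtx H → Set
    EH = FinGraph.E H
    E⊠ : FinGraph.Vtx G × FinGraph.Vtx H → FinGraph.Vtx G × FinGraph.Vtx H → Set
    E⊠ = StrongE G H

  proj₁-contraction : Contraction E⊠ EG proj₁
  proj₁-contraction (inj₁ (g≡g' , _))        = inj₁ g≡g'
  proj₁-contraction (inj₂ (inj₁ (_ , eg)))   = inj₂ eg
  proj₁-contraction (inj₂ (inj₂ (eg , _)))   = inj₂ eg

  proj₂-contraction : Contraction E⊠ EH proj₂
  proj₂-contraction (inj₁ (_ , eh))          = inj₂ eh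
  proj₂-contraction (inj₂ (inj₁ (h≡h' , _))) = inj₁ h≡h'
  proj₂-contraction (inj₂ (inj₂ (_ , eh)))   = inj₂ eh

  layerG : (h : FinGraph.Vtx H) → Hom EG E⊠ (λ g → (g , h))
  layerG h eg = inj₂ (inj₁ (refl , eg))

  layerH : (g : FinGraph.Vtx G) → Hom EH E⊠ (λ h → (g , h))
  layerH g eh = inj₁ (refl , eh)

  diagonal : ∀ {g g' h h' α n} → Walk EG g g' α → Walk EH h h' n → α ≤ n →
             Walk E⊠ (g , h) (g' , h') n
  diagonal nil          nil          _       = nil
  diagonal nil          (cons eh wh) _       = cons (inj₁ (refl , eh)) (diagonal nil wh z≤n)
  diagonal (cons eg wg) (cons eh wh) (s≤s p) = cons (inj₂ (inj₂ (eg , eh))) (diagonal wg wh p)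

  coverByAnchors : ∀ {S₁ S₂ a b} (AG : Anchor EG S₁ a) (AH : Anchor EH S₂ b) →
                   Anchor.α AG ≤ Anchor.α AH → IntervalSet E⊠ (S₁ ⊠ˢ S₂) (a , b)
  coverByAnchors AG AH αG≤αH =
    (c , x) , (c , y) , (Sc , Sx) , (Sc , Sy) , split⇒interval record
      { i = i ; i' = i'
      ; toA = diagonal c→a toA (≤-trans αG≤αH α≤i)
      ; fromA = diagonal a→c fromA (≤-trans αG≤αH α≤i')
      ; tight = tightPullback proj₂-contraction tight }
    where
      open Anchor AG using (c; Sc; c→a; a→c)
      open Anchor AH using (x; y; Sx; Sy; geo; α≤i; α≤i')
      open Split geo

swapHom : (G H : FinGraph) → Hom (StrongE H G) (StrongE G H) swap
swapHom G H (inj₁ (h≡h' , eg))        = inj₂ (inj₁ (h≡h' , eg))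
swapHom G H (inj₂ (inj₁ (g≡g' , eh))) = inj₁ (g≡g' , eh)
swapHom G H (inj₂ (inj₂ (eh , eg)))   = inj₂ (inj₂ (eg , eh))

swapIntervalSet : (G H : FinGraph) {S₁ : Pred (FinGraph.Vtx G) 0ℓ} {S₂ : Pred (FinGraph.Vtx H) 0ℓ}
                  {a : FinGraph.Vtx G} {b : FinGraph.Vtx H} →
                  IntervalSet (StrongE H G) (S₂ ⊠ˢ S₁) (b , a) →
                  IntervalSet (StrongE G H) (S₁ ⊠ˢ S₂) (a , b)
swapIntervalSet G H =
  intervalSetImage {E = StrongE H G} {E' = StrongE G H}
    (swapHom G H) (homContraction {E = StrongE G H} {E' = StrongE H G} (swapHom H G))
    (λ _ → refl) swap

strongGeodetic : (G H : FinGraph) (S₁ : Pred (FinGraph.Vtx G) 0ℓ) (S₂ : Pred (FinGraph.Vtx H) 0ℓ) →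
                 Geodetic (FinGraph.E G) S₁ → Geodetic (FinGraph.E H) S₂ →
                 Geodetic (StrongE G H) (S₁ ⊠ˢ S₂)
strongGeodetic G H S₁ S₂ geoG geoH (a , b) =
  coverByNearer (anchor (symmetric G) (geoG a)) (anchor (symmetric H) (geoH b))
  where
    coverByNearer : Anchor (FinGraph.E G) S₁ a → Anchor (FinGraph.E H) S₂ b →
                    IntervalSet (StrongE G H) (S₁ ⊠ˢ S₂) (a , b)
    coverByNearer AG AH with ≤-total (Anchor.α AG) (Anchor.α AH)
    ... | inj₁ αG≤αH = Strong.coverByAnchors G H AG AH αG≤αH
    ... | inj₂ αH≤αG = swapIntervalSet G H (Strong.coverByAnchors H G AH AG αH≤αG)

strongHull : (G H : FinGraph) (S₁ : Pred (FinGraph.Vtx G) 0ℓ) (S₂ : Pred (FinGraph.Vtx H) 0ℓ) →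
             HullSet (FinGraph.E G) S₁ → HullSet (FinGraph.E H) S₂ →
             HullSet (StrongE G H) (S₁ ⊠ˢ S₂)
strongHull G H S₁ S₂ hullG hullH (a , b) C convC S⊆C =
  hullH b (λ h → C (a , h)) (convexPullback (layerH a) proj₂-contraction (λ _ → refl) convC)
          (λ s∈S₂ → layerFull s∈S₂ a)
  where
    open Strong G H
    -- For s ∈ S₂ the layer G × {s} of C is convex and contains S₁, hence is all of G.
    layerFull : ∀ {s} → S₂ s → ∀ g → C (g , s)
    layerFull {s} s∈S₂ g =
      hullG g (λ g → C (g , s)) (convexPullback (layerG s) proj₁-contraction (λ _ → refl) convC)
            (λ t∈S₁ → S⊆C (t∈S₁ , s∈S₂))

proposition1 : (G H : FinGraph) →
    2 ≤ FinGraph.n G → 2 ≤ FinGraph.n H →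
    Connected (FinGraph.E G) → Connected (FinGraph.E H) →
    (S₁ : Pred (FinGraph.Vtx G) 0ℓ) → (S₂ : Pred (FinGraph.Vtx H) 0ℓ) →
    ((Geodetic (FinGraph.E G) S₁ → Geodetic (FinGraph.E H) S₂ →
        Geodetic (StrongE G H) (S₁ ⊠ˢ S₂))
    × (HullSet (FinGraph.E G) S₁ → HullSet (FinGraph.E H) S₂ →
        HullSet (StrongE G H) (S₁ ⊠ˢ S₂)))
proposition1 G H _ _ _ _ S₁ S₂ = strongGeodetic G H S₁ S₂ , strongHull G H S₁ S₂
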